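{- Let $G$ be a complete multi-partite graph of order $n$, let $H$ be a spanning subgraph of $G$, and let $r$ be a positive integer with $n\ge 5r-2$. Suppose $H$ has at least two components, $or_2(H)\le r$ and $n-(or_1(H)+or_2(H))\le r$. Let $H_1$ be a largest component of $H$. Then there exists $S\subseteq V(H)\setminus V(H_1)$ with $|S|\le or_2(H)-1$ such that $|E(G[V(H_1)\cup S])|\ge|E(H)|$.
   Context: For a graph $H$ with components ordered by decreasing order $|V(H_1)|\ge|V(H_2)|\ge\cdots$, write $or_i(H)=|V(H_i)|$. $G[U]$ is the subgraph of $G$ induced by $U$. -}

module Defs where

open import Data.Nat using (ℕ; zero; suc; _+_; _≡ᵇ_; _<ᵇ_)
open import Data.Bool using (Bool; true; false; _∧_; not; if_then_else_; T)
open import Data.Fin using (Fin; toℕ)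
open import Data.Fin.Subset using (Subset; _∈_; _∉_; ⊤)
open import Data.List using (List; map; allFin)
open import Data.Nat.ListAction using (sum)
open import Relation.Binary.PropositionalEquality using (_≡_)
open import Data.Vec using (lookup)
open import Data.Product using (Σ; _×_; ∃)
open import Function.Bundles using (_⇔_)
open import Relation.Nullary using (¬_)

Graph : ℕ → Set
Graph n = Fin n → Fin n → Bool

IsSimple : ∀ {n} → Graph n → Set
IsSimple {n} H = (∀ (u v : Fin n) → H u v ≡ H v u) × (∀ (u : Fin n) → H u u ≡ false)

-- The complete multipartite graph whose parts are the fibres of p.
completeMultipartite : ∀ {n} → (Fin n → ℕ) → Graph n
completeMultipartite p u v = not (p u ≡ᵇ p v)

SpanningSubgraph : ∀ {n} → Graph n → Graph n → Set
SpanningSubgraph {n} H G = ∀ (u v : Fin n) → T (H u v) → T (G u v)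

data Walk {n} (H : Graph n) : Fin n → Fin n → Set where
  here : ∀ {u} → Walk H u u
  step : ∀ {u w v} → T (H u w) → Walk H w v → Walk H u v

IsComponent : ∀ {n} → Graph n → Subset n → Set
IsComponent {n} H C = ∃ λ (v : Fin n) → ∀ (u : Fin n) → (u ∈ C) ⇔ Walk H v u

edgesIn : ∀ {n} → Graph n → Subset n → ℕ
edgesIn {n} H U =
  sum (map (λ u → sum (map (λ v →
        if (toℕ u <ᵇ toℕ v) ∧ lookup U u ∧ lookup U v ∧ H u v then 1 else 0)
      (allFin n))) (allFin n))

numEdges : ∀ {n} → Graph n → ℕ
numEdges H = edgesIn H ⊤

-- |E(G[U])| is edgesIn G U.

{-# OPTIONS --safe #-}
-- Let A = V(H₁) and t = or₂(H) − 1. A vertex outside A lies in a component of order at most t + 1,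
-- so it has H-degree at most t, while H-edges leaving A do not exist. Call u ∉ A rich when it is
-- G-adjacent to at least half of A, and let S consist of the first t rich vertices. Counting edges as
-- ordered pairs, 2|E(H)| ≤ 2|E(G[A])| + Σ_{u∉A} deg_H u, and it suffices to bound the last sum by
-- 2 Σ_{u∈S} |N_G(u) ∩ A|, which is at most 2|E(G[A ∪ S])| − 2|E(G[A])|.
-- * If S contains every rich vertex: every vertex of A is G-adjacent to an endpoint of any G-edge
--   (G is complete multipartite), so each H-edge outside A has a rich endpoint u in S, whose H-degree
--   is at most t ≤ |A|/2 ≤ |N_G(u) ∩ A|.
-- * Otherwise |S| = t, and Σ_{u∉A} deg_H u ≤ (n − |A|) t ≤ t |A| ≤ Σ_{u∈S} 2 |N_G(u) ∩ A|.
-- The bounds 2t ≤ |A| and (n − |A|) t ≤ t |A| are where n ≥ 5r − 2 enters.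
module Submission where

open import Defs
open import Data.Nat using (ℕ; zero; suc; _+_; _*_; _∸_; _≤_; _≥_; _<_; z≤n; s≤s; _<ᵇ_; _≤ᵇ_; _≡ᵇ_)
open import Data.Nat.Properties
open import Data.Bool using (Bool; true; false; _∧_; _∨_; not; if_then_else_; T)
open import Data.Bool.Properties using (∧-commutativeMonoid; ∧-zeroʳ; ∧-distribʳ-∨; T-≡; T-∧; T-∨)
open import Data.Empty using (⊥-elim)
open import Data.Fin using (Fin; toℕ; zero; suc)
open import Data.Fin.Properties using (toℕ-injective; any?)
open import Data.Fin.Subset using (Subset; _∈_; _∉_; _⊆_; _⊂_; _∪_; _∩_; ∁; ⊤; ⊥; ⁅_⁆; ∣_∣; inside; outside)
open import Data.Fin.Subset.Properties
  using (_∈?_; ∈⊤; ∉⊥; ∣⊥∣≡0; ∣⁅x⁆∣≡1; x∈⁅x⁆; x∈⁅y⁆⇒x≡y; ∣p∣≤n; p⊆q⇒∣p∣≤∣q∣; drop-∷-⊆; drop-∷-⊂;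
         ⊆-antisym; p⊆p∪q; q⊆p∪q; x∈p∪q⁻; x∈p∩q⁺; x∈p∩q⁻; x∈p⇒x∉∁p; x∈∁p⇒x∉p; x∉p⇒x∈∁p; p∪∁p≡⊤; ∣∁p∣≡n∸∣p∣)
open import Data.List as List using (allFin)
open import Data.List.Properties using (map-tabulate)
open import Data.Nat.ListAction using () renaming (sum to listSum)
open import Data.Vec using ([]; _∷_; lookup; tabulate; here; there)
open import Data.Vec.Properties using (lookup∘tabulate; []=⇒lookup; lookup⇒[]=; lookup-zipWith)
open import Data.Product using (_×_; _,_; proj₁; proj₂; ∃)
open import Data.Sum using (_⊎_; inj₁; inj₂; [_,_])
open import Function using (_∘_; id; _⇔_; mk⇔; Equivalence)
open import Relation.Nullary using (¬_; yes; no; contradiction)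
open import Relation.Nullary.Decidable using (_×-dec_; ¬?; T?; isYes; toWitness; fromWitness; decidable-stable)
open import Relation.Binary.PropositionalEquality using (_≡_; _≢_; refl; sym; trans; cong; subst; module ≡-Reasoning)
open import Data.Nat.Tactic.RingSolver using (solve-∀)
open import Algebra.Bundles using (CommutativeMonoid)
open import Algebra.Properties.CommutativeSemigroup (CommutativeMonoid.commutativeSemigroup ∧-commutativeMonoid) 
  using () renaming (x∙yz≈y∙xz to ∧-exchange)
open import Algebra.Properties.Semiring.Sum +-*-semiring using (sum-cong-≗; ∑-distrib-+; ∑-comm; *-distribˡ-sum; *-distribʳ-sum; sum-syntax)

open Equivalence using (to; from)

𝟙 : Bool → ℕ
𝟙 b = if b then 1 else 0

𝟙-∧ : ∀ a b → 𝟙 (a ∧ b) ≡ 𝟙 a * 𝟙 b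
𝟙-∧ true  b = sym (*-identityˡ (𝟙 b))
𝟙-∧ false b = refl

𝟙-∨ : ∀ {a b} → (T a → ¬ T b) → 𝟙 (a ∨ b) ≡ 𝟙 a + 𝟙 b
𝟙-∨ {true}  {true}  a⇒¬b = contradiction _ (a⇒¬b _)
𝟙-∨ {true}  {false} _    = refl
𝟙-∨ {false}         _    = refl

𝟙-mono : ∀ {a b} → (T a → T b) → 𝟙 a ≤ 𝟙 b
𝟙-mono {false}         _   = z≤n
𝟙-mono {true}  {true}  _   = ≤-refl
𝟙-mono {true}  {false} a⇒b = ⊥-elim (a⇒b _)

𝟙-cover : ∀ {a b c} → (T a → T b ⊎ T c) → 𝟙 a ≤ 𝟙 b + 𝟙 c
𝟙-cover {false}                 _ = z≤n
𝟙-cover {true}  {true}          _ = s≤s z≤n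
𝟙-cover {true}  {false} {true}  _ = s≤s z≤n
𝟙-cover {true}  {false} {false} a⇒b⊎c with a⇒b⊎c _
... | inj₁ ()
... | inj₂ ()

∑-mono-≤ : ∀ {n} {f g : Fin n → ℕ} → (∀ i → f i ≤ g i) → ∑[ i < n ] f i ≤ ∑[ i < n ] g i
∑-mono-≤ {zero}  _   = z≤n
∑-mono-≤ {suc n} f≤g = +-mono-≤ (f≤g zero) (∑-mono-≤ (f≤g ∘ suc))

∑∑-mono-≤ : ∀ {n} {f g : Fin n → Fin n → ℕ} → (∀ i j → f i j ≤ g i j) →
  ∑[ i < n ] ∑[ j < n ] f i j ≤ ∑[ i < n ] ∑[ j < n ] g i j
∑∑-mono-≤ f≤g = ∑-mono-≤ λ i → ∑-mono-≤ (f≤g i)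

∑∑-distrib-+ : ∀ {n} (f g : Fin n → Fin n → ℕ) →
  ∑[ i < n ] ∑[ j < n ] (f i j + g i j) ≡ ∑[ i < n ] ∑[ j < n ] f i j + ∑[ i < n ] ∑[ j < n ] g i j
∑∑-distrib-+ {n} f g = trans (sum-cong-≗ λ i → ∑-distrib-+ (f i) (g i))
                             (∑-distrib-+ (λ i → ∑[ j < n ] f i j) (λ i → ∑[ j < n ] g i j))

listSum-map-allFin : ∀ {n} (f : Fin n → ℕ) → listSum (List.map f (allFin n)) ≡ ∑[ i < n ] f i
listSum-map-allFin f = trans (cong listSum (map-tabulate id f)) (listSum-tabulate f)
  where
  listSum-tabulate : ∀ {n} (f : Fin n → ℕ) → listSum (List.tabulate f) ≡ ∑[ i < n ] f i
  listSum-tabulate {zero}  f = refl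
  listSum-tabulate {suc n} f = cong (f zero +_) (listSum-tabulate (f ∘ suc))

∈⇒T : ∀ {n} {p : Subset n} {u} → u ∈ p → T (lookup p u)
∈⇒T u∈p = subst T (sym ([]=⇒lookup u∈p)) _

T⇒∈ : ∀ {n} {p : Subset n} {u} → T (lookup p u) → u ∈ p
T⇒∈ {p = p} {u} t = lookup⇒[]= u p (to T-≡ t)

∈-tabulate⁺ : ∀ {n} {f : Fin n → Bool} {u} → T (f u) → u ∈ tabulate f
∈-tabulate⁺ {f = f} {u} t = T⇒∈ (subst T (sym (lookup∘tabulate f u)) t)

∈-tabulate⁻ : ∀ {n} {f : Fin n → Bool} {u} → u ∈ tabulate f → T (f u)
∈-tabulate⁻ {f = f} {u} u∈ = subst T (lookup∘tabulate f u) (∈⇒T u∈)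

∣p∣≡∑𝟙 : ∀ {n} (p : Subset n) → ∣ p ∣ ≡ ∑[ u < n ] 𝟙 (lookup p u)
∣p∣≡∑𝟙 []            = refl
∣p∣≡∑𝟙 (inside  ∷ p) = cong suc (∣p∣≡∑𝟙 p)
∣p∣≡∑𝟙 (outside ∷ p) = ∣p∣≡∑𝟙 p

∑𝟙*-const : ∀ {n} (p : Subset n) c → ∑[ u < n ] (𝟙 (lookup p u) * c) ≡ ∣ p ∣ * c
∑𝟙*-const p c = trans (sym (*-distribʳ-sum c (𝟙 ∘ lookup p))) (cong (_* c) (sym (∣p∣≡∑𝟙 p)))

∑𝟙*-mono : ∀ {n} (p : Subset n) {f g : Fin n → ℕ} → (∀ {u} → u ∈ p → f u ≤ g u) →
  ∑[ u < n ] (𝟙 (lookup p u) * f u) ≤ ∑[ u < n ] (𝟙 (lookup p u) * g u)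
∑𝟙*-mono p {f} {g} f≤g = ∑-mono-≤ pointwise
  where
  pointwise : ∀ u → 𝟙 (lookup p u) * f u ≤ 𝟙 (lookup p u) * g u
  pointwise u with lookup p u in eq
  ... | outside = z≤n
  ... | inside  = +-monoˡ-≤ 0 (f≤g (lookup⇒[]= u p eq))

p⊂q⇒∣p∣<∣q∣ : ∀ {n} {p q : Subset n} → p ⊂ q → ∣ p ∣ < ∣ q ∣
p⊂q⇒∣p∣<∣q∣ {p = []}          {[]}          (_ , () , _)
p⊂q⇒∣p∣<∣q∣ {p = outside ∷ p} {outside ∷ q} p⊂q      = p⊂q⇒∣p∣<∣q∣ (drop-∷-⊂ p⊂q)
p⊂q⇒∣p∣<∣q∣ {p = outside ∷ p} {inside  ∷ q} (p⊆q , _) = s≤s (p⊆q⇒∣p∣≤∣q∣ (drop-∷-⊆ p⊆q))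
p⊂q⇒∣p∣<∣q∣ {p = inside  ∷ p} {outside ∷ q} (p⊆q , _) = contradiction (p⊆q here) λ ()
p⊂q⇒∣p∣<∣q∣ {p = inside  ∷ p} {inside  ∷ q} p⊂q      = s≤s (p⊂q⇒∣p∣<∣q∣ (drop-∷-⊂ p⊂q))

keepFirst : ∀ {n} → ℕ → Subset n → Subset n
keepFirst zero    p             = ⊥
keepFirst (suc k) []            = []
keepFirst (suc k) (outside ∷ p) = outside ∷ keepFirst (suc k) p
keepFirst (suc k) (inside  ∷ p) = inside  ∷ keepFirst k p

keepFirst-⊆ : ∀ {n} k (p : Subset n) → keepFirst k p ⊆ p
keepFirst-⊆ zero    p             x∈         = contradiction x∈ ∉⊥
keepFirst-⊆ (suc k) (outside ∷ p) (there x∈) = there (keepFirst-⊆ (suc k) p x∈)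
keepFirst-⊆ (suc k) (inside  ∷ p) here       = here
keepFirst-⊆ (suc k) (inside  ∷ p) (there x∈) = there (keepFirst-⊆ k p x∈)

∣keepFirst∣≤ : ∀ {n} k (p : Subset n) → ∣ keepFirst k p ∣ ≤ k
∣keepFirst∣≤ {n} zero    p             = ≤-reflexive (∣⊥∣≡0 n)
∣keepFirst∣≤     (suc k) []            = z≤n
∣keepFirst∣≤     (suc k) (outside ∷ p) = ∣keepFirst∣≤ (suc k) p
∣keepFirst∣≤     (suc k) (inside  ∷ p) = s≤s (∣keepFirst∣≤ k p)

p⊆keepFirst⊎∣keepFirst∣≡k : ∀ {n} k (p : Subset n) → p ⊆ keepFirst k p ⊎ ∣ keepFirst k p ∣ ≡ k
p⊆keepFirst⊎∣keepFirst∣≡k {n} zero    p  = inj₂ (∣⊥∣≡0 n)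
p⊆keepFirst⊎∣keepFirst∣≡k     (suc k) [] = inj₁ λ ()
p⊆keepFirst⊎∣keepFirst∣≡k (suc k) (outside ∷ p) with p⊆keepFirst⊎∣keepFirst∣≡k (suc k) p
... | inj₁ p⊆ = inj₁ λ { (there x∈) → there (p⊆ x∈) }
... | inj₂ eq = inj₂ eq
p⊆keepFirst⊎∣keepFirst∣≡k (suc k) (inside ∷ p) with p⊆keepFirst⊎∣keepFirst∣≡k k p
... | inj₁ p⊆ = inj₁ λ { here → here ; (there x∈) → there (p⊆ x∈) }
... | inj₂ eq = inj₂ (cong suc eq)

degIn : ∀ {n} → Graph n → Subset n → Fin n → ℕ
degIn {n} F Q u = ∑[ v < n ] 𝟙 (lookup Q v ∧ F u v)

arcs : ∀ {n} → Graph n → Subset n → Subset n → ℕ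
arcs {n} F P Q = ∑[ u < n ] ∑[ v < n ] 𝟙 (lookup P u ∧ lookup Q v ∧ F u v)

arc⁺ : ∀ {n} {F : Graph n} {P Q : Subset n} {u v} → u ∈ P → v ∈ Q → T (F u v) → T (lookup P u ∧ lookup Q v ∧ F u v)
arc⁺ u∈P v∈Q f = from T-∧ (∈⇒T u∈P , from T-∧ (∈⇒T v∈Q , f))

arc⁻ : ∀ {n} (F : Graph n) (P Q : Subset n) u v → T (lookup P u ∧ lookup Q v ∧ F u v) → u ∈ P × v ∈ Q × T (F u v)
arc⁻ F P Q u v t with to T-∧ t
... | tP , t′ with to T-∧ t′
... | tQ , f = T⇒∈ tP , T⇒∈ tQ , f

arcs≡∑degIn : ∀ {n} (F : Graph n) (P Q : Subset n) → arcs F P Q ≡ ∑[ u < n ] (𝟙 (lookup P u) * degIn F Q u)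
arcs≡∑degIn {n} F P Q = sum-cong-≗ λ u →
  trans (sum-cong-≗ λ v → 𝟙-∧ (lookup P u) (lookup Q v ∧ F u v))
        (sym (*-distribˡ-sum (𝟙 (lookup P u)) λ v → 𝟙 (lookup Q v ∧ F u v)))

arcs-mono : ∀ {n} (F F′ : Graph n) (P Q P′ Q′ : Subset n) →
  (∀ {u v} → u ∈ P → v ∈ Q → T (F u v) → u ∈ P′ × v ∈ Q′ × T (F′ u v)) →
  arcs F P Q ≤ arcs F′ P′ Q′
arcs-mono F F′ P Q P′ Q′ arc⇒arc′ = ∑∑-mono-≤ λ u v → 𝟙-mono (pointwise u v)
  where
  pointwise : ∀ u v → T (lookup P u ∧ lookup Q v ∧ F u v) → T (lookup P′ u ∧ lookup Q′ v ∧ F′ u v)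
  pointwise u v t with arc⁻ F P Q u v t
  ... | u∈P , v∈Q , f with arc⇒arc′ u∈P v∈Q f
  ... | u∈P′ , v∈Q′ , f′ = arc⁺ {F = F′} u∈P′ v∈Q′ f′

arcs-cover : ∀ {n} (F : Graph n) (P Q P₁ Q₁ P₂ Q₂ : Subset n) →
  (∀ {u v} → u ∈ P → v ∈ Q → T (F u v) → (u ∈ P₁ × v ∈ Q₁) ⊎ (u ∈ P₂ × v ∈ Q₂)) →
  arcs F P Q ≤ arcs F P₁ Q₁ + arcs F P₂ Q₂
arcs-cover {n} F P Q P₁ Q₁ P₂ Q₂ covered = begin
  arcs F P Q                                                ≤⟨ ∑∑-mono-≤ (λ u v → 𝟙-cover (pointwise u v)) ⟩
  ∑[ u < n ] ∑[ v < n ] (arc P₁ Q₁ u v + arc P₂ Q₂ u v)     ≡⟨ ∑∑-distrib-+ (arc P₁ Q₁) (arc P₂ Q₂) ⟩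
  arcs F P₁ Q₁ + arcs F P₂ Q₂                               ∎
  where
  open ≤-Reasoning
  arc : Subset n → Subset n → Fin n → Fin n → ℕ
  arc P′ Q′ u v = 𝟙 (lookup P′ u ∧ lookup Q′ v ∧ F u v)
  pointwise : ∀ u v → T (lookup P u ∧ lookup Q v ∧ F u v) →
    T (lookup P₁ u ∧ lookup Q₁ v ∧ F u v) ⊎ T (lookup P₂ u ∧ lookup Q₂ v ∧ F u v)
  pointwise u v t with arc⁻ F P Q u v t
  ... | u∈P , v∈Q , f with covered u∈P v∈Q f
  ... | inj₁ (u∈P₁ , v∈Q₁) = inj₁ (arc⁺ {F = F} u∈P₁ v∈Q₁ f)
  ... | inj₂ (u∈P₂ , v∈Q₂) = inj₂ (arc⁺ {F = F} u∈P₂ v∈Q₂ f)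

arcs-∪ˡ : ∀ {n} (F : Graph n) (P P′ Q : Subset n) → (∀ {u} → u ∈ P → u ∉ P′) →
  arcs F (P ∪ P′) Q ≡ arcs F P Q + arcs F P′ Q
arcs-∪ˡ F P P′ Q disjoint =
  trans (sum-cong-≗ λ u → sum-cong-≗ λ v → pointwise u v) (∑∑-distrib-+ (arc P) (arc P′))
  where
  arc : Subset _ → Fin _ → Fin _ → ℕ
  arc P″ u v = 𝟙 (lookup P″ u ∧ lookup Q v ∧ F u v)
  pointwise : ∀ u v → arc (P ∪ P′) u v ≡ arc P u v + arc P′ u v
  pointwise u v = begin
    𝟙 (lookup (P ∪ P′) u ∧ r)                  ≡⟨ cong (λ b → 𝟙 (b ∧ r)) (lookup-zipWith _∨_ u P P′) ⟩
    𝟙 ((lookup P u ∨ lookup P′ u) ∧ r)         ≡⟨ cong 𝟙 (∧-distribʳ-∨ r (lookup P u) (lookup P′ u)) ⟩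
    𝟙 ((lookup P u ∧ r) ∨ (lookup P′ u ∧ r))   ≡⟨ 𝟙-∨ exclusive ⟩
    arc P u v + arc P′ u v                     ∎
    where
    open ≡-Reasoning
    r = lookup Q v ∧ F u v
    exclusive : T (lookup P u ∧ r) → ¬ T (lookup P′ u ∧ r)
    exclusive t t′ = disjoint (T⇒∈ (proj₁ (to T-∧ t))) (T⇒∈ (proj₁ (to T-∧ t′)))

arcs-comm : ∀ {n} {F : Graph n} → (∀ u v → F u v ≡ F v u) → ∀ P Q → arcs F P Q ≡ arcs F Q P
arcs-comm {n} {F} F-sym P Q =
  trans (∑-comm λ u v → 𝟙 (lookup P u ∧ lookup Q v ∧ F u v)) (sum-cong-≗ λ v → sum-cong-≗ λ u → cong 𝟙 (swap u v))
  where
  swap : ∀ u v → lookup P u ∧ lookup Q v ∧ F u v ≡ lookup Q v ∧ lookup P u ∧ F v u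
  swap u v = trans (∧-exchange (lookup P u) (lookup Q v) (F u v)) (cong (λ b → lookup Q v ∧ lookup P u ∧ b) (F-sym u v))

split-by-order : ∀ m n x → (m ≡ n → x ≡ 0) → x ≡ 𝟙 (m <ᵇ n) * x + 𝟙 (n <ᵇ m) * x
split-by-order zero    zero    x m≡n⇒x≡0 = m≡n⇒x≡0 refl
split-by-order zero    (suc n) x _       = sym (trans (+-identityʳ (x + 0)) (+-identityʳ x))
split-by-order (suc m) zero    x _       = sym (+-identityʳ x)
split-by-order (suc m) (suc n) x m≡n⇒x≡0 = split-by-order m n x (m≡n⇒x≡0 ∘ cong suc)

2*∑∑<≡∑∑ : ∀ {n} (g : Fin n → Fin n → ℕ) → (∀ u v → g u v ≡ g v u) → (∀ u → g u u ≡ 0) →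
  2 * ∑[ u < n ] ∑[ v < n ] (𝟙 (toℕ u <ᵇ toℕ v) * g u v) ≡ ∑[ u < n ] ∑[ v < n ] g u v
2*∑∑<≡∑∑ {n} g g-sym g-diag = sym (begin
  ∑[ u < n ] ∑[ v < n ] g u v                         ≡⟨ sum-cong-≗ (λ u → sum-cong-≗ λ v → split u v) ⟩
  ∑[ u < n ] ∑[ v < n ] (below u v + above u v)       ≡⟨ ∑∑-distrib-+ below above ⟩
  L + ∑[ u < n ] ∑[ v < n ] above u v                 ≡⟨ cong (L +_) above≡below ⟩
  L + L                                               ≡⟨ cong (L +_) (sym (+-identityʳ L)) ⟩
  2 * L                                               ∎)
  where
  open ≡-Reasoning
  below above : Fin n → Fin n → ℕ
  below u v = 𝟙 (toℕ u <ᵇ toℕ v) * g u v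
  above u v = 𝟙 (toℕ v <ᵇ toℕ u) * g u v
  L : ℕ
  L = ∑[ u < n ] ∑[ v < n ] below u v
  split : ∀ u v → g u v ≡ below u v + above u v
  split u v = split-by-order (toℕ u) (toℕ v) (g u v) λ eq → subst (λ w → g u w ≡ 0) (toℕ-injective eq) (g-diag u)
  above≡below : ∑[ u < n ] ∑[ v < n ] above u v ≡ L
  above≡below = trans (∑-comm above) (sum-cong-≗ λ v → sum-cong-≗ λ u → cong (𝟙 (toℕ v <ᵇ toℕ u) *_) (g-sym u v))

2*edgesIn≡arcs : ∀ {n} (F : Graph n) → IsSimple F → ∀ U → 2 * edgesIn F U ≡ arcs F U U
2*edgesIn≡arcs {n} F (F-sym , F-loopless) U =
  trans (cong (2 *_) edgesIn≡∑∑) (2*∑∑<≡∑∑ g g-sym g-diag)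
  where
  g : Fin n → Fin n → ℕ
  g u v = 𝟙 (lookup U u ∧ lookup U v ∧ F u v)
  edgesIn≡∑∑ : edgesIn F U ≡ ∑[ u < n ] ∑[ v < n ] (𝟙 (toℕ u <ᵇ toℕ v) * g u v)
  edgesIn≡∑∑ = trans (listSum-map-allFin λ u → listSum (List.map (edge u) (allFin n)))
    (sum-cong-≗ λ u → trans (listSum-map-allFin (edge u))
      (sum-cong-≗ λ v → 𝟙-∧ (toℕ u <ᵇ toℕ v) (lookup U u ∧ lookup U v ∧ F u v)))
    where
    edge : Fin n → Fin n → ℕ
    edge u v = 𝟙 ((toℕ u <ᵇ toℕ v) ∧ lookup U u ∧ lookup U v ∧ F u v)
  g-sym : ∀ u v → g u v ≡ g v u
  g-sym u v = cong 𝟙 (trans (∧-exchange (lookup U u) (lookup U v) (F u v))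
                            (cong (λ b → lookup U v ∧ lookup U u ∧ b) (F-sym u v)))
  g-diag : ∀ u → g u u ≡ 0
  g-diag u = cong 𝟙 (trans (cong (λ b → lookup U u ∧ lookup U u ∧ b) (F-loopless u))
                           (trans (cong (lookup U u ∧_) (∧-zeroʳ _)) (∧-zeroʳ _)))

≡ᵇ-comm : ∀ m n → (m ≡ᵇ n) ≡ (n ≡ᵇ m)
≡ᵇ-comm zero    zero    = refl
≡ᵇ-comm zero    (suc n) = refl
≡ᵇ-comm (suc m) zero    = refl
≡ᵇ-comm (suc m) (suc n) = ≡ᵇ-comm m n

T-not-≡ᵇ⇔≢ : ∀ {m n} → T (not (m ≡ᵇ n)) ⇔ m ≢ n
T-not-≡ᵇ⇔≢ {m} {n} with m ≡ᵇ n in eq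
... | true  = mk⇔ (λ ()) (λ m≢n → m≢n (≡ᵇ⇒≡ m n (subst T (sym eq) _)))
... | false = mk⇔ (λ _ m≡n → subst T eq (≡⇒≡ᵇ m n m≡n)) (λ _ → _)

completeMultipartite-simple : ∀ {n} (p : Fin n → ℕ) → IsSimple (completeMultipartite p)
completeMultipartite-simple p =
  (λ u v → cong not (≡ᵇ-comm (p u) (p v))) , (λ u → cong not (to T-≡ (≡⇒≡ᵇ (p u) (p u) refl)))

EdgesDominate : ∀ {n} → Graph n → Set
EdgesDominate {n} G = ∀ {u v} (w : Fin n) → T (G u v) → T (G u w) ⊎ T (G v w)

completeMultipartite-edgesDominate : ∀ {n} (p : Fin n → ℕ) → EdgesDominate (completeMultipartite p)
completeMultipartite-edgesDominate p {u} {v} w uv with p u ≟ p w | p v ≟ p w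
... | no pu≢pw  | _         = inj₁ (from T-not-≡ᵇ⇔≢ pu≢pw)
... | yes _     | no pv≢pw  = inj₂ (from T-not-≡ᵇ⇔≢ pv≢pw)
... | yes pu≡pw | yes pv≡pw = contradiction (trans pu≡pw (sym pv≡pw)) (to T-not-≡ᵇ⇔≢ uv)

walk-snoc : ∀ {n} {H : Graph n} {u w v} → Walk H u w → T (H w v) → Walk H u v
walk-snoc here         h = step h here
walk-snoc (step h′ uw) h = step h′ (walk-snoc uw h)

component-closed : ∀ {n} {H : Graph n} {C} → IsComponent H C → ∀ {u v} → u ∈ C → T (H u v) → v ∈ C
component-closed (_ , C⇔walk) u∈C h = from (C⇔walk _) (walk-snoc (to (C⇔walk _) u∈C) h)

module _ {n} (H : Graph n) where

  neighbours : Subset n → Subset n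
  neighbours R = tabulate λ v → isYes (any? λ u → u ∈? R ×-dec T? (H u v))

  expand : Subset n → Subset n
  expand R = R ∪ neighbours R

  Closed : Subset n → Set
  Closed R = expand R ⊆ R

  ∈expand⁺ : ∀ {R u v} → u ∈ R → T (H u v) → v ∈ expand R
  ∈expand⁺ {R} u∈R h = q⊆p∪q R (neighbours R) (∈-tabulate⁺ (fromWitness (_ , u∈R , h)))

  ∈expand⁻ : ∀ {R v} → v ∈ expand R → v ∈ R ⊎ ∃ λ u → u ∈ R × T (H u v)
  ∈expand⁻ {R} v∈ with x∈p∪q⁻ R (neighbours R) v∈
  ... | inj₁ v∈R = inj₁ v∈R
  ... | inj₂ v∈N = inj₂ (toWitness (∈-tabulate⁻ v∈N))

  closed⊎⊂expand : ∀ R → Closed R ⊎ R ⊂ expand R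
  closed⊎⊂expand R with any? (λ v → v ∈? expand R ×-dec ¬? (v ∈? R))
  ... | yes (v , v∈ , v∉R) = inj₂ (p⊆p∪q (neighbours R) , v , v∈ , v∉R)
  ... | no ∄               = inj₁ λ {v} v∈ → decidable-stable (v ∈? R) λ v∉R → ∄ (v , v∈ , v∉R)

  reach : Fin n → ℕ → Subset n
  reach x zero    = ⁅ x ⁆
  reach x (suc k) = expand (reach x k)

  closed⊎growing : ∀ x k → Closed (reach x k) ⊎ k < ∣ reach x k ∣
  closed⊎growing x zero = inj₂ (≤-reflexive (sym (∣⁅x⁆∣≡1 x)))
  closed⊎growing x (suc k) with closed⊎⊂expand (reach x k) | closed⊎growing x k
  ... | inj₂ (_ , v , v∈ , v∉R) | inj₁ closed = contradiction (closed v∈) v∉R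
  ... | inj₂ R⊂expand          | inj₂ k<∣R∣ = inj₂ (<-≤-trans (s≤s k<∣R∣) (p⊂q⇒∣p∣<∣q∣ R⊂expand))
  ... | inj₁ closed            | _          =
    inj₁ (subst Closed (sym (⊆-antisym closed (p⊆p∪q (neighbours (reach x k))))) closed)

  reach-closed : ∀ x → Closed (reach x n)
  reach-closed x with closed⊎growing x n
  ... | inj₁ closed = closed
  ... | inj₂ n<∣R∣  = contradiction (∣p∣≤n (reach x n)) (<⇒≱ n<∣R∣)

  x∈reach : ∀ x k → x ∈ reach x k
  x∈reach x zero    = x∈⁅x⁆ x
  x∈reach x (suc k) = p⊆p∪q _ (x∈reach x k)

  reach⇒walk : ∀ x k {v} → v ∈ reach x k → Walk H x v
  reach⇒walk x zero v∈ with x∈⁅y⁆⇒x≡y x v∈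
  ... | refl = here
  reach⇒walk x (suc k) v∈ with ∈expand⁻ v∈
  ... | inj₁ v∈R             = reach⇒walk x k v∈R
  ... | inj₂ (u , u∈R , h)   = walk-snoc (reach⇒walk x k u∈R) h

  closed-walk : ∀ {R} → Closed R → ∀ {u v} → u ∈ R → Walk H u v → v ∈ R
  closed-walk closed u∈R here        = u∈R
  closed-walk closed u∈R (step h uv) = closed-walk closed (closed (∈expand⁺ u∈R h)) uv

  component-of : ∀ x → ∃ λ K → IsComponent H K × x ∈ K
  component-of x = reach x n , (x , λ v → mk⇔ (reach⇒walk x n) (closed-walk (reach-closed x) (x∈reach x n))) , x∈reach x n

suc-degIn≤∣K∣ : ∀ {n} {H : Graph n} {x} {K : Subset n} → H x x ≡ false → x ∈ K → (∀ {v} → T (H x v) → v ∈ K) →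
  suc (degIn H ⊤ x) ≤ ∣ K ∣
suc-degIn≤∣K∣ {n} {H} {x} {K} loopless x∈K N⊆K = begin
  suc (degIn H ⊤ x)                                        ≡⟨ cong (_+ degIn H ⊤ x) (trans (sym (∣⁅x⁆∣≡1 x)) (∣p∣≡∑𝟙 ⁅ x ⁆)) ⟩
  ∑[ v < n ] 𝟙 (lookup ⁅ x ⁆ v) + degIn H ⊤ x              ≡⟨ sym (∑-distrib-+ (𝟙 ∘ lookup ⁅ x ⁆) λ v → 𝟙 (lookup ⊤ v ∧ H x v)) ⟩
  ∑[ v < n ] (𝟙 (lookup ⁅ x ⁆ v) + 𝟙 (lookup ⊤ v ∧ H x v)) ≤⟨ ∑-mono-≤ pointwise ⟩
  ∑[ v < n ] 𝟙 (lookup K v)                                ≡⟨ sym (∣p∣≡∑𝟙 K) ⟩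
  ∣ K ∣                                                    ∎
  where
  open ≤-Reasoning
  pointwise : ∀ v → 𝟙 (lookup ⁅ x ⁆ v) + 𝟙 (lookup ⊤ v ∧ H x v) ≤ 𝟙 (lookup K v)
  pointwise v = ≤-trans (≤-reflexive (sym (𝟙-∨ exclusive))) (𝟙-mono covered)
    where
    exclusive : T (lookup ⁅ x ⁆ v) → ¬ T (lookup ⊤ v ∧ H x v)
    exclusive t t′ with x∈⁅y⁆⇒x≡y x (T⇒∈ t)
    ... | refl = subst T loopless (proj₂ (to T-∧ t′))
    covered : T (lookup ⁅ x ⁆ v ∨ (lookup ⊤ v ∧ H x v)) → T (lookup K v)
    covered t with to T-∨ t
    ... | inj₁ t₁ with x∈⁅y⁆⇒x≡y x (T⇒∈ t₁)
    ...   | refl = ∈⇒T x∈K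
    covered t | inj₂ t₂ = ∈⇒T (N⊆K (proj₂ (to T-∧ t₂)))

2*x≡x+x : ∀ x → 2 * x ≡ x + x
2*x≡x+x x = cong (x +_) (+-identityʳ x)

≤+⇒≤2*⊎≤2* : ∀ {a} x y → a ≤ x + y → a ≤ 2 * x ⊎ a ≤ 2 * y
≤+⇒≤2*⊎≤2* {a} x y a≤x+y with ≤-total x y
... | inj₁ x≤y = inj₂ (≤-trans a≤x+y (≤-trans (+-monoˡ-≤ y x≤y) (≤-reflexive (sym (2*x≡x+x y)))))
... | inj₂ y≤x = inj₁ (≤-trans a≤x+y (≤-trans (+-monoʳ-≤ x y≤x) (≤-reflexive (sym (2*x≡x+x x)))))

2*[o∸1]≤a : ∀ {a m o} r → 5 * r ∸ 2 ≤ a + m → o ≤ r → m ≤ o + r → 2 * (o ∸ 1) ≤ a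
2*[o∸1]≤a                 zero    _    z≤n _     = z≤n
2*[o∸1]≤a {a} {m} {o} (suc k) size o≤r m≤o+r = +-cancelʳ-≤ m (2 * (o ∸ 1)) a (begin
  2 * (o ∸ 1) + m                   ≤⟨ +-mono-≤ (*-monoʳ-≤ 2 (∸-monoˡ-≤ 1 o≤r)) (≤-trans m≤o+r (+-monoˡ-≤ (suc k) o≤r)) ⟩
  2 * k + (suc k + suc k)           ≤⟨ m≤m+n _ (suc k) ⟩
  2 * k + (suc k + suc k) + suc k   ≡⟨ sym (normalise k) ⟩
  3 + 5 * k                         ≡⟨ cong (_∸ 2) (sym (*-suc 5 k)) ⟩
  5 * suc k ∸ 2                     ≤⟨ size ⟩
  a + m                             ∎)
  where
  open ≤-Reasoning
  normalise : ∀ k → 3 + 5 * k ≡ 2 * k + (suc k + suc k) + suc k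
  normalise = solve-∀

m*[o∸1]≤[o∸1]*a : ∀ {a m o} r → 5 * r ∸ 2 ≤ a + m → o ≤ r → m ≤ o + r → m * (o ∸ 1) ≤ (o ∸ 1) * a
m*[o∸1]≤[o∸1]*a {m = m} {zero}        _ _ _ _ = ≤-reflexive (*-zeroʳ m)
m*[o∸1]≤[o∸1]*a {m = m} {suc zero}    _ _ _ _ = ≤-reflexive (*-zeroʳ m)
m*[o∸1]≤[o∸1]*a {o = suc (suc _)}     zero          _ () _
m*[o∸1]≤[o∸1]*a {o = suc (suc _)}     (suc zero)    _ (s≤s ()) _
m*[o∸1]≤[o∸1]*a {a} {m} {suc (suc o)} (suc (suc k)) size o≤r m≤o+r =
  ≤-trans (*-monoˡ-≤ (suc o) m≤a) (≤-reflexive (*-comm a (suc o)))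
  where
  open ≤-Reasoning
  r = suc (suc k)
  normalise : ∀ k → 3 + 5 * suc k ≡ (suc (suc k) + suc (suc k)) + (suc (suc k) + suc (suc k)) + k
  normalise = solve-∀
  m≤r+r : m ≤ r + r
  m≤r+r = ≤-trans m≤o+r (+-monoˡ-≤ r o≤r)
  m≤a : m ≤ a
  m≤a = +-cancelʳ-≤ m m a (begin
    m + m                       ≤⟨ +-mono-≤ m≤r+r m≤r+r ⟩
    (r + r) + (r + r)           ≤⟨ m≤m+n _ k ⟩
    (r + r) + (r + r) + k       ≡⟨ sym (normalise k) ⟩
    3 + 5 * suc k               ≡⟨ cong (_∸ 2) (sym (*-suc 5 (suc k))) ⟩
    5 * r ∸ 2                   ≤⟨ size ⟩
    a + m                       ∎)

∣p∣+∣∁p∣≡n : ∀ {n} (p : Subset n) → ∣ p ∣ + ∣ ∁ p ∣ ≡ n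
∣p∣+∣∁p∣≡n p = trans (cong (∣ p ∣ +_) (∣∁p∣≡n∸∣p∣ p)) (m+[n∸m]≡n (∣p∣≤n p))

∣∁p∣≤o+[n∸[∣p∣+o]] : ∀ {n} (p : Subset n) o → ∣ ∁ p ∣ ≤ o + (n ∸ (∣ p ∣ + o))
∣∁p∣≤o+[n∸[∣p∣+o]] {n} p o = begin
  ∣ ∁ p ∣                     ≡⟨ ∣∁p∣≡n∸∣p∣ p ⟩
  n ∸ ∣ p ∣                   ≤⟨ m≤n+m∸n (n ∸ ∣ p ∣) o ⟩
  o + (n ∸ ∣ p ∣ ∸ o)         ≡⟨ cong (o +_) (∸-+-assoc n ∣ p ∣ o) ⟩
  o + (n ∸ (∣ p ∣ + o))       ∎
  where open ≤-Reasoning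

degIn≤order∸1 : ∀ {n} {H : Graph n} {C₁ : Subset n} {o} → (∀ u → H u u ≡ false) →
  (∀ C → IsComponent H C → C ≢ C₁ → ∣ C ∣ ≤ o) → ∀ {u} → u ∉ C₁ → degIn H ⊤ u ≤ o ∸ 1
degIn≤order∸1 {H = H} loopless others≤o {u} u∉C₁ with component-of H u
... | K , K-component , u∈K = ∸-monoˡ-≤ 1 (≤-trans
        (suc-degIn≤∣K∣ {H = H} (loopless u) u∈K (component-closed K-component u∈K))
        (others≤o K K-component λ { refl → u∉C₁ u∈K }))

module _ {n} {G H : Graph n} (G-simple : IsSimple G) (H-sym : ∀ u v → H u v ≡ H v u)
         (H⊆G : SpanningSubgraph H G) (G-dominating : EdgesDominate G)
         {A : Subset n} (A-closed : ∀ {u v} → u ∈ A → T (H u v) → v ∈ A)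
         {t : ℕ} (degIn-outside : ∀ {u} → u ∉ A → degIn H ⊤ u ≤ t)
         (2t≤∣A∣ : 2 * t ≤ ∣ A ∣) (∣∁A∣t≤t∣A∣ : ∣ ∁ A ∣ * t ≤ t * ∣ A ∣) where

  private
    d : Fin n → ℕ
    d = degIn G A

    rich : Subset n
    rich = tabulate λ u → ∣ A ∣ ≤ᵇ 2 * d u

    S : Subset n
    S = keepFirst t (∁ A ∩ rich)

    W : ℕ
    W = arcs G S A

    S-outside : ∀ {u} → u ∈ S → u ∉ A
    S-outside u∈S = x∈∁p⇒x∉p (proj₁ (x∈p∩q⁻ (∁ A) rich (keepFirst-⊆ t _ u∈S)))

    S-rich : ∀ {u} → u ∈ S → ∣ A ∣ ≤ 2 * d u
    S-rich {u} u∈S = ≤ᵇ⇒≤ ∣ A ∣ (2 * d u) (∈-tabulate⁻ (proj₂ (x∈p∩q⁻ (∁ A) rich (keepFirst-⊆ t _ u∈S))))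

    W≡∑d : W ≡ ∑[ u < n ] (𝟙 (lookup S u) * d u)
    W≡∑d = arcs≡∑degIn G S A

    ∣A∣≤d+d : ∀ {u v} → T (G u v) → ∣ A ∣ ≤ d u + d v
    ∣A∣≤d+d {u} {v} uv = begin
      ∣ A ∣                                                         ≡⟨ ∣p∣≡∑𝟙 A ⟩
      ∑[ w < n ] 𝟙 (lookup A w)                                     ≤⟨ ∑-mono-≤ (λ w → 𝟙-cover (covered w)) ⟩
      ∑[ w < n ] (𝟙 (lookup A w ∧ G u w) + 𝟙 (lookup A w ∧ G v w)) ≡⟨ ∑-distrib-+ (λ w → 𝟙 (lookup A w ∧ G u w)) _ ⟩
      d u + d v                                                     ∎
      where
      open ≤-Reasoning
      covered : ∀ w → T (lookup A w) → T (lookup A w ∧ G u w) ⊎ T (lookup A w ∧ G v w)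
      covered w w∈A with G-dominating w uv
      ... | inj₁ uw = inj₁ (from T-∧ (w∈A , uw))
      ... | inj₂ vw = inj₂ (from T-∧ (w∈A , vw))

    rich-endpoint : ∀ {u v} → u ∉ A → T (H u v) → u ∈ ∁ A ∩ rich ⊎ v ∈ ∁ A ∩ rich
    rich-endpoint {u} {v} u∉A h with ≤+⇒≤2*⊎≤2* (d u) (d v) (∣A∣≤d+d (H⊆G u v h))
    ... | inj₁ u-rich = inj₁ (x∈p∩q⁺ (x∉p⇒x∈∁p u∉A , ∈-tabulate⁺ (≤⇒≤ᵇ u-rich)))
    ... | inj₂ v-rich = inj₂ (x∈p∩q⁺ (x∉p⇒x∈∁p v∉A , ∈-tabulate⁺ (≤⇒≤ᵇ v-rich)))
      where
      v∉A : v ∉ A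
      v∉A v∈A = u∉A (A-closed v∈A (subst T (H-sym u v) h))

    arcsH-inside : arcs H A ⊤ ≤ arcs G A A
    arcsH-inside = arcs-mono H G A ⊤ A A λ u∈A _ h → u∈A , A-closed u∈A h , H⊆G _ _ h

    arcsH-outside-saturated : ∁ A ∩ rich ⊆ S → arcs H (∁ A) ⊤ ≤ 2 * W
    arcsH-outside-saturated rich⊆S = begin
      arcs H (∁ A) ⊤            ≤⟨ arcs-cover H (∁ A) ⊤ S ⊤ ⊤ S (λ u∈∁A _ h → [ (λ u∈X → inj₁ (rich⊆S u∈X , ∈⊤)) , (λ v∈X → inj₂ (∈⊤ , rich⊆S v∈X)) ]
                                                             (rich-endpoint (x∈∁p⇒x∉p u∈∁A) h)) ⟩
      arcs H S ⊤ + arcs H ⊤ S   ≡⟨ cong (arcs H S ⊤ +_) (arcs-comm H-sym ⊤ S) ⟩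
      arcs H S ⊤ + arcs H S ⊤   ≤⟨ +-mono-≤ arcsH-S≤W arcsH-S≤W ⟩
      W + W                     ≡⟨ sym (2*x≡x+x W) ⟩
      2 * W                     ∎
      where
      open ≤-Reasoning
      arcsH-S≤W : arcs H S ⊤ ≤ W
      arcsH-S≤W = begin
        arcs H S ⊤                                    ≡⟨ arcs≡∑degIn H S ⊤ ⟩
        ∑[ u < n ] (𝟙 (lookup S u) * degIn H ⊤ u)     ≤⟨ ∑𝟙*-mono S (λ u∈S → ≤-trans (degIn-outside (S-outside u∈S))
                                                                          (*-cancelˡ-≤ 2 (≤-trans 2t≤∣A∣ (S-rich u∈S)))) ⟩
        ∑[ u < n ] (𝟙 (lookup S u) * d u)             ≡⟨ sym W≡∑d ⟩
        W                                             ∎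

    arcsH-outside-full : ∣ S ∣ ≡ t → arcs H (∁ A) ⊤ ≤ 2 * W
    arcsH-outside-full ∣S∣≡t = begin
      arcs H (∁ A) ⊤                                    ≡⟨ arcs≡∑degIn H (∁ A) ⊤ ⟩
      ∑[ u < n ] (𝟙 (lookup (∁ A) u) * degIn H ⊤ u)     ≤⟨ ∑𝟙*-mono (∁ A) (degIn-outside ∘ x∈∁p⇒x∉p) ⟩
      ∑[ u < n ] (𝟙 (lookup (∁ A) u) * t)               ≡⟨ ∑𝟙*-const (∁ A) t ⟩
      ∣ ∁ A ∣ * t                                       ≤⟨ ∣∁A∣t≤t∣A∣ ⟩
      t * ∣ A ∣                                         ≡⟨ cong (_* ∣ A ∣) (sym ∣S∣≡t) ⟩
      ∣ S ∣ * ∣ A ∣                                     ≡⟨ sym (∑𝟙*-const S ∣ A ∣) ⟩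
      ∑[ u < n ] (𝟙 (lookup S u) * ∣ A ∣)               ≤⟨ ∑𝟙*-mono S S-rich ⟩
      ∑[ u < n ] (𝟙 (lookup S u) * (2 * d u))           ≡⟨ sum-cong-≗ (λ u → x*[2*y]≡2*[x*y] (𝟙 (lookup S u)) (d u)) ⟩
      ∑[ u < n ] (2 * (𝟙 (lookup S u) * d u))           ≡⟨ sym (*-distribˡ-sum 2 λ u → 𝟙 (lookup S u) * d u) ⟩
      2 * ∑[ u < n ] (𝟙 (lookup S u) * d u)             ≡⟨ cong (2 *_) (sym W≡∑d) ⟩
      2 * W                                             ∎
      where
      open ≤-Reasoning
      x*[2*y]≡2*[x*y] : ∀ x y → x * (2 * y) ≡ 2 * (x * y)
      x*[2*y]≡2*[x*y] = solve-∀

    arcsH-outside : arcs H (∁ A) ⊤ ≤ 2 * W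
    arcsH-outside with p⊆keepFirst⊎∣keepFirst∣≡k t (∁ A ∩ rich)
    ... | inj₁ rich⊆S = arcsH-outside-saturated rich⊆S
    ... | inj₂ ∣S∣≡t  = arcsH-outside-full ∣S∣≡t

    arcsG-extension : arcs G A A + 2 * W ≤ arcs G (A ∪ S) (A ∪ S)
    arcsG-extension = begin
      arcs G A A + 2 * W                        ≡⟨ cong (arcs G A A +_) (2*x≡x+x W) ⟩
      arcs G A A + (W + W)                      ≡⟨ sym (+-assoc (arcs G A A) W W) ⟩
      arcs G A A + W + W                        ≤⟨ +-monoʳ-≤ (arcs G A A + W) (arcs-mono G G S A S (A ∪ S) λ u∈S v∈A g → u∈S , p⊆p∪q S v∈A , g) ⟩
      arcs G A A + W + arcs G S (A ∪ S)         ≡⟨ cong (_+ arcs G S (A ∪ S)) (sym (arcs-∪ˡ G A S A A∩S≡∅)) ⟩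
      arcs G (A ∪ S) A + arcs G S (A ∪ S)       ≡⟨ cong (_+ arcs G S (A ∪ S)) (arcs-comm (proj₁ G-simple) (A ∪ S) A) ⟩
      arcs G A (A ∪ S) + arcs G S (A ∪ S)       ≡⟨ sym (arcs-∪ˡ G A S (A ∪ S) A∩S≡∅) ⟩
      arcs G (A ∪ S) (A ∪ S)                    ∎
      where
      open ≤-Reasoning
      A∩S≡∅ : ∀ {u} → u ∈ A → u ∉ S
      A∩S≡∅ u∈A u∈S = S-outside u∈S u∈A

  arcs-extension : ∃ λ S → (∀ {u} → u ∈ S → u ∉ A) × ∣ S ∣ ≤ t × arcs H ⊤ ⊤ ≤ arcs G (A ∪ S) (A ∪ S)
  arcs-extension = S , S-outside , ∣keepFirst∣≤ t (∁ A ∩ rich) , (begin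
    arcs H ⊤ ⊤                          ≡⟨ cong (λ P → arcs H P ⊤) (sym (p∪∁p≡⊤ A)) ⟩
    arcs H (A ∪ ∁ A) ⊤                  ≡⟨ arcs-∪ˡ H A (∁ A) ⊤ x∈p⇒x∉∁p ⟩
    arcs H A ⊤ + arcs H (∁ A) ⊤         ≤⟨ +-mono-≤ arcsH-inside arcsH-outside ⟩
    arcs G A A + 2 * W                  ≤⟨ arcsG-extension ⟩
    arcs G (A ∪ S) (A ∪ S)              ∎)
    where open ≤-Reasoning

lemma7p1 : (n r : ℕ) (p : Fin n → ℕ) (H : Graph n)
    → IsSimple H
    → SpanningSubgraph H (completeMultipartite p)
    → 1 ≤ r
    → 5 * r ∸ 2 ≤ n
    → (C₁ : Subset n) → IsComponent H C₁
    → (∀ (C : Subset n) → IsComponent H C → ∣ C ∣ ≤ ∣ C₁ ∣)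
    → (o₂ : ℕ)
    → (∃ λ (C₂ : Subset n) → IsComponent H C₂ × C₂ ≢ C₁ × ∣ C₂ ∣ ≡ o₂)
    → (∀ (C : Subset n) → IsComponent H C → C ≢ C₁ → ∣ C ∣ ≤ o₂)
    → o₂ ≤ r
    → n ∸ (∣ C₁ ∣ + o₂) ≤ r
    → ∃ λ (S : Subset n) → (∀ (u : Fin n) → u ∈ S → u ∉ C₁)
        × ∣ S ∣ ≤ o₂ ∸ 1
        × edgesIn (completeMultipartite p) (C₁ ∪ S) ≥ numEdges H
lemma7p1 n r p H H-simple H⊆G _ 5r∸2≤n C₁ C₁-component _ o₂ _ others≤o₂ o₂≤r rest≤r =
  let S , S-outside , ∣S∣≤ , arcs≤ = arcs-extension G-simple (proj₁ H-simple) H⊆G (completeMultipartite-edgesDominate p)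
        (component-closed C₁-component) (degIn≤order∸1 (proj₂ H-simple) others≤o₂)
        (2*[o∸1]≤a r size o₂≤r ∣∁C₁∣≤o₂+r) (m*[o∸1]≤[o∸1]*a r size o₂≤r ∣∁C₁∣≤o₂+r)
  in S , (λ _ → S-outside) , ∣S∣≤ , *-cancelˡ-≤ 2 (begin
    2 * numEdges H                  ≡⟨ 2*edgesIn≡arcs H H-simple ⊤ ⟩
    arcs H ⊤ ⊤                      ≤⟨ arcs≤ ⟩
    arcs G (C₁ ∪ S) (C₁ ∪ S)        ≡⟨ sym (2*edgesIn≡arcs G G-simple (C₁ ∪ S)) ⟩
    2 * edgesIn G (C₁ ∪ S)          ∎)
  where
  open ≤-Reasoning
  G = completeMultipartite p
  G-simple = completeMultipartite-simple p
  size : 5 * r ∸ 2 ≤ ∣ C₁ ∣ + ∣ ∁ C₁ ∣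
  size = ≤-trans 5r∸2≤n (≤-reflexive (sym (∣p∣+∣∁p∣≡n C₁)))
  ∣∁C₁∣≤o₂+r : ∣ ∁ C₁ ∣ ≤ o₂ + r
  ∣∁C₁∣≤o₂+r = ≤-trans (∣∁p∣≤o+[n∸[∣p∣+o]] C₁ o₂) (+-monoʳ-≤ o₂ rest≤r)
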